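{- Let $\varphi\in\mathrm{Fm}_{\mathsf S}$ and $a,b\in Ag$. Then for every $n\geq1$, $\vdash_{\mathsf S}S_{a,b}\varphi\to I_a^nS_{a,b}\varphi$.
   Context: Let $Ag$ be a non-empty finite set of agents and $Var$ a countably infinite set of propositional variables. The formulas $\mathrm{Fm}_{\mathsf S}$ are generated by $\varphi::=p\mid\neg\varphi\mid\varphi\land\varphi\mid I_a\varphi\mid K_a\varphi\mid B_a\varphi$ ($p\in Var$, $a\in Ag$), with $\lor,\to$ classical abbreviations. The logic $\mathsf S$ ($\vdash_{\mathsf S}\varphi$ means $\varphi$ is derivable) has as axioms: all classical tautologies; for each $a$ and $\star\in\{K_a,B_a,I_a\}$, $\star(\varphi\to\psi)\to(\star\varphi\to\star\psi)$; $K_a\varphi\to\varphi$; $K_a\varphi\to K_aK_a\varphi$; $B_a\varphi\to\neg B_a\neg\varphi$; $K_a\varphi\to B_a\varphi$; $B_a\varphi\to K_aB_a\varphi$; $I_a\varphi\to\neg I_a\neg\varphi$; $I_a\varphi\to K_aI_a\varphi$; $I_a\varphi\to I_aK_a\varphi$; $I_a\varphi\to I_aI_a\varphi$; rules: modus ponens and necessitation for each $K_a,B_a,I_a$. For agents $a,b$ (not necessarily distinct) and a formula $\varphi$, $S_{a,b}\varphi:=K_a\varphi\land B_a\neg K_b\varphi\land I_a(\varphi\land\neg K_b\varphi)$. For $\Box\in\{K_a,B_a,I_a\}$, $\Box^0\varphi:=\varphi$ and $\Box^{n+1}\varphi:=\Box\Box^n\varphi$. -}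

module Defs where

open import Data.Nat using (ℕ; zero; suc)
open import Data.Fin using (Fin)
open import Data.Bool using (Bool; true; false; not; _∧_)
open import Relation.Binary.PropositionalEquality using (_≡_)

module _ (m : ℕ) where

  Ag : Set
  Ag = Fin (suc m)

  data Fm : Set where
    var : ℕ → Fm
    ¬'_ : Fm → Fm
    _∧'_ : Fm → Fm → Fm
    I K B : Ag → Fm → Fm

  infixr 6 _∧'_
  infixr 5 _∨'_
  infixr 4 _⇒_

  _∨'_ : Fm → Fm → Fm
  φ ∨' ψ = ¬' ((¬' φ) ∧' (¬' ψ))

  _⇒_ : Fm → Fm → Fm
  φ ⇒ ψ = ¬' (φ ∧' (¬' ψ))

  -- Classical truth value, with modal subformulas treated as atoms
  -- (interpreted by an arbitrary valuation on all formulas).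
  eval : (Fm → Bool) → Fm → Bool
  eval v (var p) = v (var p)
  eval v (¬' φ) = not (eval v φ)
  eval v (φ ∧' ψ) = eval v φ ∧ eval v ψ
  eval v (I a φ) = v (I a φ)
  eval v (K a φ) = v (K a φ)
  eval v (B a φ) = v (B a φ)

  Tautology : Fm → Set
  Tautology φ = (v : Fm → Bool) → eval v φ ≡ true

  data ⊢S_ : Fm → Set where
    taut : ∀ {φ} → Tautology φ → ⊢S φ
    distK : ∀ a φ ψ → ⊢S (K a (φ ⇒ ψ) ⇒ (K a φ ⇒ K a ψ))
    distB : ∀ a φ ψ → ⊢S (B a (φ ⇒ ψ) ⇒ (B a φ ⇒ B a ψ))
    distI : ∀ a φ ψ → ⊢S (I a (φ ⇒ ψ) ⇒ (I a φ ⇒ I a ψ))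
    kT : ∀ a φ → ⊢S (K a φ ⇒ φ)
    k4 : ∀ a φ → ⊢S (K a φ ⇒ K a (K a φ))
    bD : ∀ a φ → ⊢S (B a φ ⇒ ¬' (B a (¬' φ)))
    kb : ∀ a φ → ⊢S (K a φ ⇒ B a φ)
    bkb : ∀ a φ → ⊢S (B a φ ⇒ K a (B a φ))
    iD : ∀ a φ → ⊢S (I a φ ⇒ ¬' (I a (¬' φ)))
    iki : ∀ a φ → ⊢S (I a φ ⇒ K a (I a φ))
    iik : ∀ a φ → ⊢S (I a φ ⇒ I a (K a φ))
    iii : ∀ a φ → ⊢S (I a φ ⇒ I a (I a φ))
    mp : ∀ {φ ψ} → ⊢S (φ ⇒ ψ) → ⊢S φ → ⊢S ψ
    necK : ∀ a {φ} → ⊢S φ → ⊢S (K a φ)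
    necB : ∀ a {φ} → ⊢S φ → ⊢S (B a φ)
    necI : ∀ a {φ} → ⊢S φ → ⊢S (I a φ)

  S : Ag → Ag → Fm → Fm
  S a b φ = K a φ ∧' (B a (¬' (K b φ)) ∧' I a (φ ∧' (¬' (K b φ))))

  Iⁿ : Ag → ℕ → Fm → Fm
  Iⁿ a zero φ = φ
  Iⁿ a (suc n) φ = I a (Iⁿ a n φ)

{-# OPTIONS --safe #-}
module Submission where

-- S_{a,b} φ contains I_a χ with χ = φ ∧ ¬K_b φ, and by the axioms I_a ψ → I_a K_a ψ and
-- I_a ψ → I_a I_a ψ, the formula I_a χ already yields I_a K_a φ, I_a B_a ¬K_b φ (via K_a → B_a)
-- and I_a I_a χ, hence I_a S_{a,b} φ.  Iterating ⊢ X → I_a X under I_a gives every power.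

open import Defs
open import Data.Nat using (ℕ; _≥_; zero; suc; s≤s)
open import Data.Fin using (Fin; zero; suc)
open import Data.Vec using (Vec; []; _∷_; lookup; map)
open import Data.Vec.Properties using (lookup-map)
open import Data.Bool using (Bool; true; false; not; _∧_; T)
open import Data.Bool.Properties using (T-≡; T-∧)
open import Data.Product using (proj₁; proj₂)
open import Function.Bundles using (Equivalence)
open import Relation.Binary.PropositionalEquality using (_≡_; sym; cong; cong₂; trans)

open Equivalence using (to)

isTautology : ∀ n → (Vec Bool n → Bool) → Bool
isTautology zero    f = f []
isTautology (suc n) f = isTautology n (λ xs → f (true ∷ xs)) ∧ isTautology n (λ xs → f (false ∷ xs))

isTautology-sound : ∀ n (f : Vec Bool n → Bool) → T (isTautology n f) → ∀ xs → f xs ≡ true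
isTautology-sound zero    f holds []           = to T-≡ holds
isTautology-sound (suc n) f holds (true ∷ xs)  = isTautology-sound n _ (proj₁ (to T-∧ holds)) xs
isTautology-sound (suc n) f holds (false ∷ xs) = isTautology-sound n _ (proj₂ (to T-∧ holds)) xs

data Schema (n : ℕ) : Set where
  ‵_   : Fin n → Schema n
  ¬ₛ_  : Schema n → Schema n
  _∧ₛ_ : Schema n → Schema n → Schema n

infixr 6 _∧ₛ_
infixr 4 _⇒ₛ_

_⇒ₛ_ : ∀ {n} → Schema n → Schema n → Schema n
s ⇒ₛ t = ¬ₛ (s ∧ₛ ¬ₛ t)

⟦_⟧ : ∀ {n} → Schema n → Vec Bool n → Bool
⟦ ‵ i    ⟧ xs = lookup xs i
⟦ ¬ₛ s   ⟧ xs = not (⟦ s ⟧ xs)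
⟦ s ∧ₛ t ⟧ xs = ⟦ s ⟧ xs ∧ ⟦ t ⟧ xs

P : ∀ {n} → Schema (suc n)
P = ‵ zero

Q : ∀ {n} → Schema (suc (suc n))
Q = ‵ suc zero

R : ∀ {n} → Schema (suc (suc (suc n)))
R = ‵ suc (suc zero)

module _ {m : ℕ} where

  infix  2 ⊢_
  infixr 4 _⟶_

  ⊢_ : Fm m → Set
  ⊢_ = ⊢S_ m

  _⟶_ : Fm m → Fm m → Fm m
  _⟶_ = _⇒_ m

  _[_] : ∀ {n} → Schema n → Vec (Fm m) n → Fm m
  (‵ i)    [ Xs ] = lookup Xs i
  (¬ₛ s)   [ Xs ] = ¬' (s [ Xs ])
  (s ∧ₛ t) [ Xs ] = s [ Xs ] ∧' t [ Xs ]

  eval-[] : ∀ {n} v (s : Schema n) Xs → eval m v (s [ Xs ]) ≡ ⟦ s ⟧ (map (eval m v) Xs)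
  eval-[] v (‵ i)    Xs = sym (lookup-map i (eval m v) Xs)
  eval-[] v (¬ₛ s)   Xs = cong not (eval-[] v s Xs)
  eval-[] v (s ∧ₛ t) Xs = cong₂ _∧_ (eval-[] v s Xs) (eval-[] v t Xs)

  taut-instance : ∀ {n} (s : Schema n) → T (isTautology n ⟦ s ⟧) → ∀ Xs → ⊢ s [ Xs ]
  taut-instance {n} s holds Xs = taut λ v →
    trans (eval-[] v s Xs) (isTautology-sound n ⟦ s ⟧ holds (map (eval m v) Xs))

  ⇒-trans : ∀ {X Y Z} → ⊢ X ⟶ Y → ⊢ Y ⟶ Z → ⊢ X ⟶ Z
  ⇒-trans {X} {Y} {Z} = λ p q → mp (mp syllogism p) q
    where
    syllogism : ⊢ (X ⟶ Y) ⟶ (Y ⟶ Z) ⟶ X ⟶ Z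
    syllogism = taut-instance ((P ⇒ₛ Q) ⇒ₛ (Q ⇒ₛ R) ⇒ₛ P ⇒ₛ R) _ (X ∷ Y ∷ Z ∷ [])

  ∧-elimˡ : ∀ {X Y} → ⊢ X ∧' Y ⟶ X
  ∧-elimˡ {X} {Y} = taut-instance (P ∧ₛ Q ⇒ₛ P) _ (X ∷ Y ∷ [])

  ∧-elimʳ : ∀ {X Y} → ⊢ X ∧' Y ⟶ Y
  ∧-elimʳ {X} {Y} = taut-instance (P ∧ₛ Q ⇒ₛ Q) _ (X ∷ Y ∷ [])

  ∧-intro : ∀ {X Y Z} → ⊢ X ⟶ Y → ⊢ X ⟶ Z → ⊢ X ⟶ Y ∧' Z
  ∧-intro {X} {Y} {Z} = λ p q → mp (mp pairing p) q
    where
    pairing : ⊢ (X ⟶ Y) ⟶ (X ⟶ Z) ⟶ X ⟶ Y ∧' Z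
    pairing = taut-instance ((P ⇒ₛ Q) ⇒ₛ (P ⇒ₛ R) ⇒ₛ P ⇒ₛ Q ∧ₛ R) _ (X ∷ Y ∷ Z ∷ [])

  uncurry : ∀ {X Y Z} → ⊢ X ⟶ Y ⟶ Z → ⊢ X ∧' Y ⟶ Z
  uncurry {X} {Y} {Z} = mp (taut-instance ((P ⇒ₛ Q ⇒ₛ R) ⇒ₛ P ∧ₛ Q ⇒ₛ R) _ (X ∷ Y ∷ Z ∷ []))

  record Normal (□ : Fm m → Fm m) : Set where
    field
      dist : ∀ φ ψ → ⊢ □ (φ ⟶ ψ) ⟶ □ φ ⟶ □ ψ
      nec  : ∀ {φ} → ⊢ φ → ⊢ □ φ

    mono : ∀ {φ ψ} → ⊢ φ ⟶ ψ → ⊢ □ φ ⟶ □ ψ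
    mono {φ} {ψ} p = mp (dist φ ψ) (nec p)

    ∧-distrib : ∀ {φ ψ} → ⊢ □ φ ∧' □ ψ ⟶ □ (φ ∧' ψ)
    ∧-distrib {φ} {ψ} = uncurry (⇒-trans (mono pair) (dist ψ (φ ∧' ψ)))
      where
      pair : ⊢ φ ⟶ ψ ⟶ φ ∧' ψ
      pair = taut-instance (P ⇒ₛ Q ⇒ₛ P ∧ₛ Q) _ (φ ∷ ψ ∷ [])

  K-normal : ∀ a → Normal (K a)
  K-normal a = record { dist = distK a ; nec = necK a }

  I-normal : ∀ a → Normal (I a)
  I-normal a = record { dist = distI a ; nec = necI a }

  module K□ a = Normal (K-normal a)
  module I□ a = Normal (I-normal a)

  ⇒-I-∧ : ∀ {a X Y Z} → ⊢ X ⟶ I a Y → ⊢ X ⟶ I a Z → ⊢ X ⟶ I a (Y ∧' Z)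
  ⇒-I-∧ {a} p q = ⇒-trans (∧-intro p q) (I□.∧-distrib a)

  I-conjunct⇒I-S : ∀ a b φ → ⊢ I a (φ ∧' ¬' K b φ) ⟶ I a (S m a b φ)
  I-conjunct⇒I-S a b φ =
    ⇒-I-∧ (⇒-trans (iik a _) (I□.mono a (K□.mono a ∧-elimˡ)))
   (⇒-I-∧ (⇒-trans (iik a _) (I□.mono a (⇒-trans (K□.mono a ∧-elimʳ) (kb a _))))
          (iii a _))

  S⇒I-S : ∀ a b φ → ⊢ S m a b φ ⟶ I a (S m a b φ)
  S⇒I-S a b φ = ⇒-trans (⇒-trans ∧-elimʳ ∧-elimʳ) (I-conjunct⇒I-S a b φ)

  ⇒-Iⁿ-iterate : ∀ {a X} → ⊢ X ⟶ I a X → ∀ n → ⊢ X ⟶ Iⁿ m a (suc n) X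
  ⇒-Iⁿ-iterate p zero    = p
  ⇒-Iⁿ-iterate p (suc n) = ⇒-trans p (I□.mono _ (⇒-Iⁿ-iterate p n))

proposition4 : (m : ℕ) (φ : Fm m) (a b : Ag m) (n : ℕ) → n ≥ 1 →
    ⊢S_ m (_⇒_ m (S m a b φ) (Iⁿ m a n (S m a b φ)))
proposition4 m φ a b (suc n) (s≤s _) = ⇒-Iⁿ-iterate (S⇒I-S a b φ) n
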